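{- For every even integer $m\geq 2$, $b(K_m \times P_2) \geq \frac{m^2}{2}$.
   Context: For a finite simple graph $G$, the brush number $b(G)$ is the minimum, over all acyclic orientations of the edges of $G$, of $\sum_{v\in V(G)} \max\{0,d^+(v)-d^-(v)\}$, where $d^+(v)$ and $d^-(v)$ are the outdegree and indegree of $v$ in the orientation (equivalently, the minimum number of brushes needed to clean $G$ in the graph cleaning process). $K_m$ is the complete graph on $m$ vertices and $P_n$ is the path on $n$ vertices. The cartesian product $G\times H$ has vertex set $V(G)\times V(H)$, with $(a,b)$ adjacent to $(c,d)$ iff either $a=c$ and $bd\in E(H)$, or $ac\in E(G)$ and $b=d$. -}

module Defs where

open import Data.Bool using (Bool; true; false; _∧_; _∨_; not)
open import Data.Nat using (ℕ; zero; suc; _+_; _∸_; _≤_; _<_; _*_)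
open import Data.Fin using (Fin; zero; suc)
open import Data.Fin.Properties using (_≟_)
open import Data.List using (List; []; _∷_; map; allFin; cartesianProduct)
open import Data.Nat.ListAction using (sum)
open import Data.Product using (_×_; _,_)
open import Data.Product.Properties using (≡-dec)
open import Data.Sum using (_⊎_)
open import Relation.Nullary using (¬_)
open import Relation.Nullary.Decidable using (⌊_⌋)
open import Relation.Binary.PropositionalEquality using (_≡_)
open import Relation.Binary.Definitions using (DecidableEquality)
open import Relation.Binary.Construct.Closure.Transitive using (TransClosure)

-- A finite (simple) graph: a vertex type, the list of its vertices
-- (each exactly once), and a Boolean adjacency relation.
record Graph : Set₁ where
  field
    V     : Set
    verts : List V
    _≟V_  : DecidableEquality V
    adj   : V → V → Bool
open Graph public

count : {A : Set} → (A → Bool) → List A → ℕ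
count p []       = 0
count p (x ∷ xs) = b2n (p x) + count p xs
  where
  b2n : Bool → ℕ
  b2n true  = 1
  b2n false = 0

record Orientation (G : Graph) : Set where
  field
    arc      : V G → V G → Bool
    arc-edge : ∀ u v → arc u v ≡ true → adj G u v ≡ true
    one-dir  : ∀ u v → adj G u v ≡ true →
               (arc u v ≡ true × arc v u ≡ false) ⊎ (arc u v ≡ false × arc v u ≡ true)
open Orientation public

Acyclic : {G : Graph} → Orientation G → Set
Acyclic {G} o = ∀ v → ¬ TransClosure (λ a b → arc o a b ≡ true) v v

outdeg indeg : {G : Graph} → Orientation G → V G → ℕ
outdeg {G} o v = count (λ w → arc o v w) (verts G)
indeg  {G} o v = count (λ w → arc o w v) (verts G)

-- sum over v of max{0, d⁺(v) − d⁻(v)}  (truncated subtraction in ℕ)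
cost : {G : Graph} → Orientation G → ℕ
cost {G} o = sum (map (λ v → outdeg o v ∸ indeg o v) (verts G))

-- "b(G) ≥ k": every acyclic orientation has cost at least k
-- (b(G) is the minimum of cost over acyclic orientations).
BrushNumberAtLeast : Graph → ℕ → Set
BrushNumberAtLeast G k = (o : Orientation G) → Acyclic o → k ≤ cost o

K : ℕ → Graph
K m = record { V = Fin m ; verts = allFin m ; _≟V_ = _≟_ ; adj = λ i j → not ⌊ i ≟ j ⌋ }

P : ℕ → Graph
P n = record { V = Fin n ; verts = allFin n ; _≟V_ = _≟_ ; adj = λ i j → nb i j ∨ nb j i }
  where
  nb : ∀ {n} → Fin n → Fin n → Bool
  nb zero    (suc zero) = true
  nb (suc i) (suc j)    = nb i j
  nb _       _          = false

_□_ : Graph → Graph → Graph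
G □ H = record
  { V = V G × V H
  ; verts = cartesianProduct (verts G) (verts H)
  ; _≟V_ = ≡-dec (_≟V_ G) (_≟V_ H)
  ; adj = λ { (a , b) (c , d) →
        (eqG a c ∧ adj H b d) ∨ (adj G a c ∧ eqH b d) } }
  where
  eqG : V G → V G → Bool
  eqG a c = ⌊ _≟V_ G a c ⌋
  eqH : V H → V H → Bool
  eqH b d = ⌊ _≟V_ H b d ⌋

module Submission where

-- Let o be an acyclic orientation of K_m □ P_2.  Restricted to either copy of K_m
-- (a "layer") it is a transitive tournament, so the scores (out-degrees inside the
-- layer) are pairwise distinct; hence at least m − k vertices have score ≥ k, and the
-- scores exceed h by at least 0 + 1 + ⋯ + (h − 1) in total.  Every vertex has degree
-- m = 2h, so a vertex of score c whose rung points away from its layer contributes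
-- 2·((c + 1) ∸ h) to the cost, otherwise 2·(c ∸ h).  Finally, at least h vertices
-- with score ≥ h (in either layer) have their rung pointing away: otherwise we find
-- a directed 4-cycle through two rungs.  Altogether cost ≥ 2·h(h−1) + 2h = 2h².

open import Defs
open import Data.Bool using (Bool; true; false; not; _∧_)
open import Data.Bool.Properties using () renaming (_≟_ to _≟ᴮ_)
open import Data.Nat using (ℕ; zero; suc; pred; _+_; _*_; _∸_; _/_; _≤_; _<_; z≤n; s≤s; _≤?_; _<?_)
open import Data.Nat.Properties
  using (+-0-commutativeMonoid; +-*-semiring; +-mono-≤; *-monoʳ-≤; +-identityʳ; +-assoc; +-comm; +-suc;
         +-cancelˡ-≤; *-distribˡ-+; ≤-refl; ≤-reflexive; ≤-trans; <-irrefl; <-trans; <-≤-trans;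
         module ≤-Reasoning; 0∸n≡0; m+n∸m≡n; +-∸-comm; +-∸-assoc; ∸-monoˡ-≤; m≤n⇒m∸n≡0;
         ≰⇒>; <⇒≱; ≤∧≢⇒<; ≤-pred; <⇒≢; m<m+n; m≤m+n; n≤1+n)
  renaming (_≟_ to _≟ℕ_)
open import Data.Nat.Divisibility using (_∣_; divides)
open import Data.Nat.DivMod using (m*n/n≡m)
open import Data.Nat.ListAction using () renaming (sum to sumList)
open import Data.Nat.Tactic.RingSolver using (solve-∀)
open import Data.Fin using (Fin; zero; suc; punchIn)
open import Data.Fin.Properties using (_≟_; any?; punchInᵢ≢i; suc-injective)
open import Data.Fin.Patterns using (0F; 1F)
open import Data.List using (List; []; _∷_; map; tabulate; allFin; cartesianProduct)
open import Data.Product using (_×_; _,_)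
open import Data.Sum using (_⊎_; inj₁; inj₂)
open import Data.Empty using (⊥; ⊥-elim)
open import Function using (_∘_)
open import Function.Definitions using (Injective)
open import Relation.Nullary using (¬_; yes; no; contradiction)
open import Relation.Nullary.Decidable using (Dec; _×-dec_; ⌊_⌋; dec-true; dec-false; isYes≗does)
open import Relation.Binary.PropositionalEquality
  using (_≡_; _≢_; refl; sym; trans; cong; cong₂; subst; module ≡-Reasoning)
open import Relation.Binary.Construct.Closure.Transitive using () renaming ([_] to [_]⁺; _∷_ to _◅_)
open import Algebra.Properties.CommutativeMonoid.Sum +-0-commutativeMonoid
  using (sum; sum-syntax; ∑-distrib-+; sum-cong-≗; sum-remove; sum-replicate-zero)
open import Algebra.Properties.Semiring.Sum +-*-semiring using (*-distribˡ-sum)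

⌊⌋-true : ∀ {A : Set} (d : Dec A) → A → ⌊ d ⌋ ≡ true
⌊⌋-true d a = trans (isYes≗does d) (dec-true d a)

⌊⌋-false : ∀ {A : Set} (d : Dec A) → ¬ A → ⌊ d ⌋ ≡ false
⌊⌋-false d ¬a = trans (isYes≗does d) (dec-false d ¬a)

⌊⌋-sound : ∀ {A : Set} (d : Dec A) → ⌊ d ⌋ ≡ true → A
⌊⌋-sound (yes a) _ = a

⌊⌋-refute : ∀ {A : Set} (d : Dec A) → ⌊ d ⌋ ≡ false → ¬ A
⌊⌋-refute (no ¬a) _ = ¬a

true-and-false : ∀ {b} → b ≡ true → b ≡ false → ⊥
true-and-false refl ()

[_] : Bool → ℕ
[ true ]  = 1
[ false ] = 0

sum-mono : ∀ {n} {f g : Fin n → ℕ} → (∀ i → f i ≤ g i) → sum f ≤ sum g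
sum-mono {zero}  _   = z≤n
sum-mono {suc n} f≤g = +-mono-≤ (f≤g zero) (sum-mono (f≤g ∘ suc))

sum-zero : ∀ {n} {f : Fin n → ℕ} → (∀ i → f i ≡ 0) → sum f ≡ 0
sum-zero {n} f≡0 = trans (sum-cong-≗ f≡0) (sum-replicate-zero n)

sum-ones : ∀ n → ∑[ i < n ] 1 ≡ n
sum-ones zero    = refl
sum-ones (suc n) = cong suc (sum-ones n)

sum-single : ∀ {n} (f : Fin n → ℕ) (i : Fin n) → (∀ j → j ≢ i → f j ≡ 0) → sum f ≡ f i
sum-single {suc n} f i off = begin
  sum f                      ≡⟨ sum-remove {i = i} f ⟩
  f i + sum (f ∘ punchIn i)  ≡⟨ cong (f i +_) (sum-zero (λ j → off _ (punchInᵢ≢i i j))) ⟩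
  f i + 0                    ≡⟨ +-identityʳ (f i) ⟩
  f i                        ∎
  where open ≡-Reasoning

sum-point : ∀ {n} (i : Fin n) → ∑[ j < n ] [ ⌊ j ≟ i ⌋ ] ≡ 1
sum-point i = trans (sum-single _ i off) (cong [_] (⌊⌋-true (i ≟ i) refl))
  where
  off : ∀ j → j ≢ i → [ ⌊ j ≟ i ⌋ ] ≡ 0
  off j j≢i = cong [_] (⌊⌋-false (j ≟ i) j≢i)

∸-step : ∀ x k → x ∸ k ≡ x ∸ suc k + [ ⌊ suc k ≤? x ⌋ ]
∸-step x k with suc k ≤? x
... | yes k<x = trans (+-∸-assoc 1 k<x) (+-comm 1 (x ∸ suc k))
... | no  k≮x = trans (m≤n⇒m∸n≡0 x≤k) (sym (cong (_+ 0) (m≤n⇒m∸n≡0 (≤-trans x≤k (n≤1+n k)))))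
  where
  x≤k : x ≤ k
  x≤k = ≤-pred (≰⇒> k≮x)

<-suc-split : ∀ x k → [ ⌊ x <? suc k ⌋ ] ≡ [ ⌊ x <? k ⌋ ] + [ ⌊ x ≟ℕ k ⌋ ]
<-suc-split x k with x <? suc k | x <? k | x ≟ℕ k
... | yes _   | yes _   | no _    = refl
... | yes _   | no _    | yes _   = refl
... | no _    | no _    | no _    = refl
... | yes _   | yes x<k | yes refl = contradiction x<k (<-irrefl refl)
... | yes x<sk | no x≮k  | no x≢k  = contradiction (≤∧≢⇒< (≤-pred x<sk) x≢k) x≮k
... | no x≮sk | _       | yes refl = contradiction ≤-refl x≮sk
... | no x≮sk | yes x<k | _       = contradiction (≤-trans x<k (n≤1+n k)) x≮sk

<-or-≥ : ∀ x k → [ ⌊ x <? k ⌋ ] + [ ⌊ k ≤? x ⌋ ] ≡ 1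
<-or-≥ x k with x <? k | k ≤? x
... | yes _   | no _    = refl
... | no _    | yes _   = refl
... | yes x<k | yes k≤x = contradiction k≤x (<⇒≱ x<k)
... | no x≮k  | no k≰x  = contradiction (≰⇒> k≰x) x≮k

-- The arithmetic of a single vertex: if its out- and in-degree e and f have mean h,
-- its contribution e ∸ f is twice e's excess over h.  (The clauses not listed
-- contradict e + f = h + h.)
difference-from-mean : ∀ h e f → e + f ≡ h + h → e ∸ f ≡ 2 * (e ∸ h)
difference-from-mean zero    zero    zero    _  = refl
difference-from-mean h       zero    (suc f) _  = sym (cong (2 *_) (0∸n≡0 h))
difference-from-mean h       (suc e) zero    eq = begin
  suc e                 ≡⟨ trans (sym (+-identityʳ (suc e))) eq ⟩
  h + h                 ≡⟨ cong (h +_) (sym (+-identityʳ h)) ⟩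
  2 * h                 ≡⟨ cong (2 *_) (sym (m+n∸m≡n h h)) ⟩
  2 * (h + h ∸ h)       ≡⟨ cong (λ x → 2 * (x ∸ h)) (trans (sym eq) (+-identityʳ (suc e))) ⟩
  2 * (suc e ∸ h)       ∎
  where open ≡-Reasoning
difference-from-mean (suc h) (suc e) (suc f) eq = difference-from-mean h e f (cong pred eq')
  where
  eq' : suc (e + f) ≡ suc (h + h)
  eq' = trans (sym (+-suc e f)) (trans (cong pred eq) (+-suc h h))

excess-bonus : ∀ h c u → (c ∸ h) + [ ⌊ h ≤? c ⌋ ∧ u ] ≤ (c + [ u ]) ∸ h
excess-bonus h c u with h ≤? c
... | yes h≤c = ≤-reflexive (sym (+-∸-comm [ u ] h≤c))
... | no  _   = ≤-trans (≤-reflexive (+-identityʳ (c ∸ h))) (∸-monoˡ-≤ h (m≤m+n c [ u ]))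

at-most-one-hit : ∀ {n} (c : Fin n → ℕ) → Injective _≡_ _≡_ c → ∀ k → ∑[ i < n ] [ ⌊ c i ≟ℕ k ⌋ ] ≤ 1
at-most-one-hit {zero}  c c-inj k = z≤n
at-most-one-hit {suc n} c c-inj k with c zero ≟ℕ k
... | yes c₀≡k = ≤-reflexive (cong suc (sum-zero miss))
  where
  miss : ∀ j → [ ⌊ c (suc j) ≟ℕ k ⌋ ] ≡ 0
  miss j = cong [_] (⌊⌋-false (c (suc j) ≟ℕ k) λ cⱼ≡k → contradiction (c-inj (trans cⱼ≡k (sym c₀≡k))) λ ())
... | no _ = at-most-one-hit (c ∘ suc) (suc-injective ∘ c-inj) k

-- A sequence c of m distinct naturals is spread out: at most k of its values are
-- below k, so at least m − k are ≥ k, and hence its total excess over k is at least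
-- the triangular number 0 + 1 + ⋯ + (m − k − 1).
module DistinctValues {m : ℕ} (c : Fin m → ℕ) (c-injective : Injective _≡_ _≡_ c) where

  below atLeast excess : ℕ → ℕ
  below   k = ∑[ i < m ] [ ⌊ c i <? k ⌋ ]
  atLeast k = ∑[ i < m ] [ ⌊ k ≤? c i ⌋ ]
  excess  k = ∑[ i < m ] (c i ∸ k)

  -- each value below k + 1 is either below k or equal to k, which happens at most once
  few-below : ∀ k → below k ≤ k
  few-below zero = ≤-reflexive (sum-zero (λ i → cong [_] (⌊⌋-false (c i <? 0) λ ())))
  few-below (suc k) = begin
    below (suc k)                                     ≡⟨ sum-cong-≗ (λ i → <-suc-split (c i) k) ⟩
    ∑[ i < m ] ([ ⌊ c i <? k ⌋ ] + [ ⌊ c i ≟ℕ k ⌋ ])  ≡⟨ ∑-distrib-+ {m} _ _ ⟩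
    below k + ∑[ i < m ] [ ⌊ c i ≟ℕ k ⌋ ]             ≤⟨ +-mono-≤ (few-below k) (at-most-one-hit c c-injective k) ⟩
    k + 1                                             ≡⟨ +-comm k 1 ⟩
    suc k                                             ∎
    where open ≤-Reasoning

  many-above : ∀ k → m ≤ k + atLeast k
  many-above k = begin
    m                                                 ≡⟨ sum-ones m ⟨
    ∑[ i < m ] 1                                      ≡⟨ sum-cong-≗ (λ i → <-or-≥ (c i) k) ⟨
    ∑[ i < m ] ([ ⌊ c i <? k ⌋ ] + [ ⌊ k ≤? c i ⌋ ])  ≡⟨ ∑-distrib-+ {m} _ _ ⟩
    below k + atLeast k                               ≤⟨ +-mono-≤ (few-below k) ≤-refl ⟩
    k + atLeast k                                     ∎
    where open ≤-Reasoning

  excess-step : ∀ k → excess k ≡ excess (suc k) + atLeast (suc k)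
  excess-step k = trans (sum-cong-≗ (λ i → ∸-step (c i) k)) (∑-distrib-+ {m} _ _)

  excess-bound : ∀ n k → k + suc n ≡ m → n * suc n ≤ 2 * excess k
  excess-bound zero    k _      = z≤n
  excess-bound (suc n) k k+n+2≡m = begin
    suc n * suc (suc n)                        ≡⟨ triangle-step n ⟩
    n * suc n + 2 * suc n                      ≤⟨ +-mono-≤ (excess-bound n (suc k) k+1+n+1≡m) (*-monoʳ-≤ 2 many) ⟩
    2 * excess (suc k) + 2 * atLeast (suc k)   ≡⟨ sym (*-distribˡ-+ 2 (excess (suc k)) (atLeast (suc k))) ⟩
    2 * (excess (suc k) + atLeast (suc k))     ≡⟨ cong (2 *_) (sym (excess-step k)) ⟩
    2 * excess k                               ∎
    where
    open ≤-Reasoning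
    triangle-step : ∀ n → suc n * suc (suc n) ≡ n * suc n + 2 * suc n
    triangle-step = solve-∀
    k+1+n+1≡m : suc k + suc n ≡ m
    k+1+n+1≡m = trans (sym (+-suc k (suc n))) k+n+2≡m
    many : suc n ≤ atLeast (suc k)
    many = +-cancelˡ-≤ (suc k) _ _ (≤-trans (≤-reflexive k+1+n+1≡m) (many-above (suc k)))

record TransitiveTournament (m : ℕ) : Set where
  field
    beats       : Fin m → Fin m → Bool
    irreflexive : ∀ i → beats i i ≡ false
    total       : ∀ {i j} → i ≢ j → beats i j ≡ true ⊎ beats j i ≡ true
    transitive  : ∀ {i j k} → beats i j ≡ true → beats j k ≡ true → beats i k ≡ true

  score loss : Fin m → ℕ
  score i = ∑[ j < m ] [ beats i j ]
  loss  i = ∑[ j < m ] [ beats j i ]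

  asymmetric : ∀ {i j} → beats i j ≡ true → beats j i ≡ false
  asymmetric {i} {j} i→j with beats j i in j→i
  ... | false = refl
  ... | true  = contradiction (irreflexive i) (true-and-false (transitive i→j j→i))

  -- every other player is either beaten by i or beats i
  score+loss : ∀ i → suc (score i + loss i) ≡ m
  score+loss i = begin
    suc (score i + loss i)                                      ≡⟨ +-comm 1 _ ⟩
    score i + loss i + 1                                        ≡⟨ cong (score i + loss i +_) (sum-point i) ⟨
    score i + loss i + ∑[ j < m ] [ ⌊ j ≟ i ⌋ ]                 ≡⟨ cong (_+ _) (∑-distrib-+ {m} _ _) ⟨
    ∑[ j < m ] ([ beats i j ] + [ beats j i ]) + ∑[ j < m ] [ ⌊ j ≟ i ⌋ ] ≡⟨ ∑-distrib-+ {m} _ _ ⟨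
    ∑[ j < m ] ([ beats i j ] + [ beats j i ] + [ ⌊ j ≟ i ⌋ ])  ≡⟨ sum-cong-≗ one-relation ⟩
    ∑[ j < m ] 1                                                ≡⟨ sum-ones m ⟩
    m                                                           ∎
    where
    open ≡-Reasoning
    one-relation : ∀ j → [ beats i j ] + [ beats j i ] + [ ⌊ j ≟ i ⌋ ] ≡ 1
    one-relation j with j ≟ i
    ... | yes refl rewrite irreflexive i = refl
    ... | no j≢i with beats i j in i→j | beats j i in j→i
    ...   | true  | true  = contradiction (asymmetric i→j) (true-and-false j→i)
    ...   | true  | false = refl
    ...   | false | true  = refl
    ...   | false | false with total (j≢i ∘ sym)
    ...     | inj₁ i→j' = contradiction i→j (true-and-false i→j')
    ...     | inj₂ j→i' = contradiction j→i (true-and-false j→i')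

  -- beating j means beating j itself and everyone j beats
  score-increasing : ∀ {i j} → beats i j ≡ true → score j < score i
  score-increasing {i} {j} i→j = begin-strict
    score j                                     <⟨ m<m+n (score j) (s≤s z≤n) ⟩
    score j + 1                                 ≡⟨ cong (score j +_) (sum-point j) ⟨
    score j + (∑[ k < m ] [ ⌊ k ≟ j ⌋ ])        ≡⟨ ∑-distrib-+ {m} _ _ ⟨
    ∑[ k < m ] ([ beats j k ] + [ ⌊ k ≟ j ⌋ ])  ≤⟨ sum-mono dominated ⟩
    score i                                     ∎
    where
    open ≤-Reasoning
    dominated : ∀ k → [ beats j k ] + [ ⌊ k ≟ j ⌋ ] ≤ [ beats i k ]
    dominated k with k ≟ j
    ... | yes refl rewrite irreflexive k | i→j = ≤-refl
    ... | no _ with beats j k in j→k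
    ...   | true  rewrite transitive i→j j→k = ≤-refl
    ...   | false = z≤n

  -- any two distinct players are comparable, so their scores differ
  score-injective : Injective _≡_ _≡_ score
  score-injective {i} {j} same with i ≟ j
  ... | yes i≡j = i≡j
  ... | no i≢j with total i≢j
  ...   | inj₁ i→j = contradiction same (<⇒≢ (score-increasing i→j) ∘ sym)
  ...   | inj₂ j→i = contradiction same (<⇒≢ (score-increasing j→i))

  beats-below : ∀ {k i j} → k ≤ score i → score j < k → beats i j ≡ true
  beats-below {k} {i} {j} k≤sᵢ sⱼ<k with i ≟ j
  ... | yes refl = contradiction k≤sᵢ (<⇒≱ sⱼ<k)
  ... | no i≢j with total i≢j
  ...   | inj₁ i→j = i→j
  ...   | inj₂ j→i = contradiction (<-trans (score-increasing j→i) (<-≤-trans sⱼ<k k≤sᵢ)) (<-irrefl refl)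

non-edge : ∀ {G} (o : Orientation G) {u v} → adj G u v ≡ false → arc o u v ≡ false
non-edge o {u} {v} u≁v with arc o u v in u→v
... | false = refl
... | true  = contradiction u≁v (true-and-false (arc-edge o u v u→v))

edge-flip : ∀ {G} (o : Orientation G) {u v} → adj G u v ≡ true → arc o v u ≡ not (arc o u v)
edge-flip o {u} {v} u~v with one-dir o u v u~v
... | inj₁ (u→v , v↛u) rewrite u→v = v↛u
... | inj₂ (u↛v , v→u) rewrite u↛v = v→u

-- The graph K m □ P 2: vertices (i , b) with i : Fin m and the layer b : Fin 2.
-- Inside a layer every two vertices are adjacent; between the layers only the
-- "rungs" (i , 0) ~ (i , 1).
other : Fin 2 → Fin 2
other 0F = 1F
other 1F = 0F

other-≢ : ∀ b → b ≢ other b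
other-≢ 0F ()
other-≢ 1F ()

adj-layer : ∀ {m} b (i j : Fin m) → adj (K m □ P 2) (i , b) (j , b) ≡ not ⌊ i ≟ j ⌋
adj-layer 0F i j with i ≟ j
... | yes _ = refl
... | no  _ = refl
adj-layer 1F i j with i ≟ j
... | yes _ = refl
... | no  _ = refl

adj-rung : ∀ {m} {b b'} → b ≢ b' → (i j : Fin m) → adj (K m □ P 2) (i , b) (j , b') ≡ ⌊ i ≟ j ⌋
adj-rung {b = 0F} {0F} b≢b' i j = contradiction refl b≢b'
adj-rung {b = 1F} {1F} b≢b' i j = contradiction refl b≢b'
adj-rung {b = 0F} {1F} _ i j with i ≟ j
... | yes _ = refl
... | no  _ = refl
adj-rung {b = 1F} {0F} _ i j with i ≟ j
... | yes _ = refl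
... | no  _ = refl

sumList-tabulate : ∀ {A : Set} n (g : Fin n → A) (f : A → ℕ) → sumList (map f (tabulate g)) ≡ sum (f ∘ g)
sumList-tabulate zero    g f = refl
sumList-tabulate (suc n) g f = cong (f (g zero) +_) (sumList-tabulate n (g ∘ suc) f)

sumList-pairs : ∀ {A : Set} (f : A × Fin 2 → ℕ) (xs : List A) →
  sumList (map f (cartesianProduct xs (allFin 2))) ≡ sumList (map (λ x → f (x , 0F) + f (x , 1F)) xs)
sumList-pairs f []       = refl
sumList-pairs f (x ∷ xs) = trans (sym (+-assoc (f (x , 0F)) _ _)) (cong (_ +_) (sumList-pairs f xs))

sum-vertices : ∀ {m} (f : Fin m × Fin 2 → ℕ) → sumList (map f (verts (K m □ P 2))) ≡ ∑[ i < m ] (f (i , 0F) + f (i , 1F))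
sum-vertices {m} f = trans (sumList-pairs f (allFin m)) (sumList-tabulate m (λ i → i) _)

count-as-sum : ∀ {A : Set} (p : A → Bool) (xs : List A) → count p xs ≡ sumList (map ([_] ∘ p) xs)
count-as-sum p []       = refl
count-as-sum p (x ∷ xs) with p x
... | true  = cong suc (count-as-sum p xs)
... | false = count-as-sum p xs

count-layers : ∀ {m} b (p : Fin m × Fin 2 → Bool) →
  count p (verts (K m □ P 2)) ≡ ∑[ j < m ] [ p (j , b) ] + ∑[ j < m ] [ p (j , other b) ]
count-layers {m} b p = trans (count-as-sum p (verts (K m □ P 2))) (trans (sum-vertices ([_] ∘ p)) (split b))
  where
  split : ∀ b → ∑[ j < m ] ([ p (j , 0F) ] + [ p (j , 1F) ]) ≡ ∑[ j < m ] [ p (j , b) ] + ∑[ j < m ] [ p (j , other b) ]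
  split 0F = ∑-distrib-+ {m} _ _
  split 1F = trans (∑-distrib-+ (λ j → [ p (j , 0F) ]) (λ j → [ p (j , 1F) ])) (+-comm (∑[ j < m ] [ p (j , 0F) ]) _)

rung-cover : ∀ {n} (top₀ top₁ u : Fin n → Bool) →
  (∀ i j → top₀ j ≡ true → top₁ j ≡ false → u j ≡ false →
           top₁ i ≡ true → top₀ i ≡ false → u i ≡ true → ⊥) →
  ∀ k → k ≤ ∑[ i < n ] [ top₀ i ] → k ≤ ∑[ i < n ] [ top₁ i ] →
  k ≤ ∑[ i < n ] [ top₀ i ∧ u i ] + ∑[ i < n ] [ top₁ i ∧ not (u i) ]
rung-cover {n} top₀ top₁ u crossing k k≤top₀ k≤top₁
  with any? (λ j → (top₀ j ≟ᴮ true) ×-dec (top₁ j ≟ᴮ false) ×-dec (u j ≟ᴮ false))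
... | no ¬down = ≤-trans k≤top₀ (≤-trans (sum-mono cover₀) (≤-reflexive (∑-distrib-+ {n} _ _)))
  where
  cover₀ : ∀ j → [ top₀ j ] ≤ [ top₀ j ∧ u j ] + [ top₁ j ∧ not (u j) ]
  cover₀ j with top₀ j in t₀ | top₁ j in t₁ | u j in uⱼ
  ... | false | _     | _     = z≤n
  ... | true  | _     | true  = s≤s z≤n
  ... | true  | true  | false = ≤-refl
  ... | true  | false | false = contradiction (j , t₀ , t₁ , uⱼ) ¬down
... | yes (j , t₀ⱼ , t₁ⱼ , uⱼ) = ≤-trans k≤top₁ (≤-trans (sum-mono cover₁) (≤-reflexive (∑-distrib-+ {n} _ _)))
  where
  cover₁ : ∀ i → [ top₁ i ] ≤ [ top₀ i ∧ u i ] + [ top₁ i ∧ not (u i) ]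
  cover₁ i with top₁ i in t₁ | top₀ i in t₀ | u i in uᵢ
  ... | false | _     | _     = z≤n
  ... | true  | true  | false = s≤s z≤n
  ... | true  | false | false = ≤-refl
  ... | true  | true  | true  = ≤-refl
  ... | true  | false | true  = ⊥-elim (crossing i j t₀ⱼ t₁ⱼ uⱼ t₁ t₀ uᵢ)

module Layers {m : ℕ} (o : Orientation (K m □ P 2)) (acyclic : Acyclic o) where

  layer : Fin 2 → TransitiveTournament m
  layer b = record
    { beats       = λ i j → arc o (i , b) (j , b)
    ; irreflexive = λ i → non-edge o (trans (adj-layer b i i) (cong not (⌊⌋-true (i ≟ i) refl)))
    ; total       = total
    ; transitive  = transitive
    }
    where
    total : ∀ {i j} → i ≢ j → arc o (i , b) (j , b) ≡ true ⊎ arc o (j , b) (i , b) ≡ true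
    total {i} {j} i≢j with arc o (i , b) (j , b) in i→j
    ... | true  = inj₁ refl
    ... | false = inj₂ (trans (edge-flip o edge) (cong not i→j))
      where
      edge : adj (K m □ P 2) (i , b) (j , b) ≡ true
      edge = trans (adj-layer b i j) (cong not (⌊⌋-false (i ≟ j) i≢j))
    transitive : ∀ {i j k} → arc o (i , b) (j , b) ≡ true → arc o (j , b) (k , b) ≡ true →
                 arc o (i , b) (k , b) ≡ true
    transitive {i} {j} {k} i→j j→k with i ≟ k
    ... | yes refl = ⊥-elim (acyclic _ (i→j ◅ [ j→k ]⁺))
    ... | no i≢k with total i≢k
    ...   | inj₁ i→k = i→k
    ...   | inj₂ k→i = ⊥-elim (acyclic _ (i→j ◅ j→k ◅ [ k→i ]⁺))

  surplus : Fin m × Fin 2 → ℕ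
  surplus v = outdeg o v ∸ indeg o v

  score loss : Fin 2 → Fin m → ℕ
  score b = TransitiveTournament.score (layer b)
  loss  b = TransitiveTournament.loss (layer b)

  up : Fin 2 → Fin m → Bool
  up b i = arc o (i , b) (i , other b)

  up-flip : ∀ b i → arc o (i , other b) (i , b) ≡ not (up b i)
  up-flip b i = edge-flip o (trans (adj-rung (other-≢ b) i i) (⌊⌋-true (i ≟ i) refl))

  off-rung : ∀ {b b'} → b ≢ b' → ∀ {i j} → j ≢ i → arc o (i , b) (j , b') ≡ false
  off-rung b≢b' {i} {j} j≢i = non-edge o (trans (adj-rung b≢b' i j) (⌊⌋-false (i ≟ j) (j≢i ∘ sym)))

  outdeg-split : ∀ b i → outdeg o (i , b) ≡ score b i + [ up b i ]
  outdeg-split b i = trans (count-layers b (arc o (i , b)))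
    (cong (score b i +_) (sum-single _ i (λ j j≢i → cong [_] (off-rung (other-≢ b) j≢i))))

  indeg-split : ∀ b i → indeg o (i , b) ≡ loss b i + [ not (up b i) ]
  indeg-split b i = trans (count-layers b (λ w → arc o w (i , b)))
    (cong (loss b i +_) (trans (sum-single _ i (λ j j≢i → cong [_] (off-rung (other-≢ b ∘ sym) (j≢i ∘ sym))))
                               (cong [_] (up-flip b i))))

  degree : ∀ b i → outdeg o (i , b) + indeg o (i , b) ≡ m
  degree b i = begin
    outdeg o (i , b) + indeg o (i , b)                    ≡⟨ cong₂ _+_ (outdeg-split b i) (indeg-split b i) ⟩
    score b i + [ up b i ] + (loss b i + [ not (up b i) ]) ≡⟨ interchange (score b i) [ up b i ] (loss b i) _ ⟩
    score b i + loss b i + ([ up b i ] + [ not (up b i) ]) ≡⟨ cong (score b i + loss b i +_) (bit-and-negation (up b i)) ⟩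
    score b i + loss b i + 1                              ≡⟨ +-comm _ 1 ⟩
    suc (score b i + loss b i)                            ≡⟨ TransitiveTournament.score+loss (layer b) i ⟩
    m                                                     ∎
    where
    open ≡-Reasoning
    interchange : ∀ a b c d → a + b + (c + d) ≡ a + c + (b + d)
    interchange = solve-∀
    bit-and-negation : ∀ u → [ u ] + [ not u ] ≡ 1
    bit-and-negation true  = refl
    bit-and-negation false = refl

module Bound {m : ℕ} (o : Orientation (K m □ P 2)) (acyclic : Acyclic o)
             (h' : ℕ) (balanced : m ≡ suc h' + suc h') where

  open Layers o acyclic

  h : ℕ
  h = suc h'

  top : Fin 2 → Fin m → Bool
  top b i = ⌊ h ≤? score b i ⌋

  bonus : Fin 2 → Fin m → ℕ
  bonus b i = [ top b i ∧ up b i ]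

  excess-at : ∀ b i → 2 * ((score b i ∸ h) + bonus b i) ≤ surplus (i , b)
  excess-at b i = begin
    2 * ((score b i ∸ h) + bonus b i)   ≤⟨ *-monoʳ-≤ 2 (excess-bonus h (score b i) (up b i)) ⟩
    2 * ((score b i + [ up b i ]) ∸ h)  ≡⟨ cong (λ d → 2 * (d ∸ h)) (outdeg-split b i) ⟨
    2 * (outdeg o (i , b) ∸ h)          ≡⟨ difference-from-mean h (outdeg o (i , b)) (indeg o (i , b)) (trans (degree b i) balanced) ⟨
    surplus (i , b)                     ∎
    where open ≤-Reasoning

  module Scores (b : Fin 2) = DistinctValues (score b) (TransitiveTournament.score-injective (layer b))
  open Scores using (excess; atLeast)

  layer-bound : ∀ b → 2 * (excess b h + ∑[ i < m ] bonus b i) ≤ ∑[ i < m ] (surplus (i , b))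
  layer-bound b = begin
    2 * (excess b h + ∑[ i < m ] bonus b i)              ≡⟨ cong (2 *_) (∑-distrib-+ {m} _ _) ⟨
    2 * (∑[ i < m ] ((score b i ∸ h) + bonus b i))       ≡⟨ *-distribˡ-sum 2 (λ i → (score b i ∸ h) + bonus b i) ⟩
    ∑[ i < m ] (2 * ((score b i ∸ h) + bonus b i))       ≤⟨ sum-mono (excess-at b) ⟩
    ∑[ i < m ] (surplus (i , b))                         ∎
    where open ≤-Reasoning

  -- scores are distinct, so at least m − h = h of them are ≥ h
  half-on-top : ∀ b → h ≤ atLeast b h
  half-on-top b = +-cancelˡ-≤ h _ _ (≤-trans (≤-reflexive (sym balanced)) (Scores.many-above b h))

  -- j ↦ i in layer 0, up the rung at i, i ↦ j in layer 1, down the rung at j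
  no-rung-cycle : ∀ i j → top 0F j ≡ true → top 1F j ≡ false → up 0F j ≡ false →
                          top 1F i ≡ true → top 0F i ≡ false → up 0F i ≡ true → ⊥
  no-rung-cycle i j t₀ⱼ t₁ⱼ ↓ⱼ t₁ᵢ t₀ᵢ ↑ᵢ = acyclic (j , 0F) (j→i ◅ ↑ᵢ ◅ i→j ◅ [ down ]⁺)
    where
    j→i : arc o (j , 0F) (i , 0F) ≡ true
    j→i = TransitiveTournament.beats-below (layer 0F)
            (⌊⌋-sound (h ≤? _) t₀ⱼ) (≰⇒> (⌊⌋-refute (h ≤? _) t₀ᵢ))
    i→j : arc o (i , 1F) (j , 1F) ≡ true
    i→j = TransitiveTournament.beats-below (layer 1F)
            (⌊⌋-sound (h ≤? _) t₁ᵢ) (≰⇒> (⌊⌋-refute (h ≤? _) t₁ⱼ))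
    down : arc o (j , 1F) (j , 0F) ≡ true
    down = trans (up-flip 0F j) (cong not ↓ⱼ)

  -- by rung-cover, since the forbidden configuration would be a directed cycle
  rung-bonus : h ≤ ∑[ i < m ] bonus 0F i + ∑[ i < m ] bonus 1F i
  rung-bonus = ≤-trans
    (rung-cover (top 0F) (top 1F) (up 0F) no-rung-cycle h (half-on-top 0F) (half-on-top 1F))
    (≤-reflexive (cong (∑[ i < m ] bonus 0F i +_) (sum-cong-≗ λ i → cong (λ u → [ top 1F i ∧ u ]) (sym (up-flip 0F i)))))

  cost-by-layers : cost o ≡ ∑[ i < m ] surplus (i , 0F) + ∑[ i < m ] surplus (i , 1F)
  cost-by-layers = trans (sum-vertices surplus) (∑-distrib-+ (λ i → surplus (i , 0F)) (λ i → surplus (i , 1F)))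

  -- each layer contributes h'(h'+1) by excess and the rungs contribute 2h
  cost-bound : 2 * (h * h) ≤ cost o
  cost-bound = begin
    2 * (h * h)                                            ≡⟨ square h' ⟩
    h' * h + h' * h + 2 * h                                ≤⟨ +-mono-≤ (+-mono-≤ (layer-excess 0F) (layer-excess 1F)) (*-monoʳ-≤ 2 rung-bonus) ⟩
    2 * E 0F + 2 * E 1F + 2 * (B 0F + B 1F)                ≡⟨ regroup (E 0F) (E 1F) (B 0F) (B 1F) ⟩
    2 * (E 0F + B 0F) + 2 * (E 1F + B 1F)                  ≤⟨ +-mono-≤ (layer-bound 0F) (layer-bound 1F) ⟩
    ∑[ i < m ] surplus (i , 0F) + ∑[ i < m ] surplus (i , 1F) ≡⟨ cost-by-layers ⟨
    cost o                                                 ∎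
    where
    open ≤-Reasoning
    E B : Fin 2 → ℕ
    E b = excess b h
    B b = ∑[ i < m ] bonus b i
    layer-excess : ∀ b → h' * h ≤ 2 * E b
    layer-excess b = Scores.excess-bound b h' h (sym balanced)
    square : ∀ h' → 2 * (suc h' * suc h') ≡ h' * suc h' + h' * suc h' + 2 * suc h'
    square = solve-∀
    regroup : ∀ e₀ e₁ b₀ b₁ → 2 * e₀ + 2 * e₁ + 2 * (b₀ + b₁) ≡ 2 * (e₀ + b₀) + 2 * (e₁ + b₁)
    regroup = solve-∀

-- Write m = 2h; m ≥ 2 forces h ≥ 1, and m²/2 = 2h².
mainTheorem3 : (m : ℕ) → 2 ≤ m → 2 ∣ m →
    BrushNumberAtLeast (K m □ P 2) ((m * m) / 2)
mainTheorem3 m () (divides zero refl)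
mainTheorem3 m _ (divides (suc h') refl) o acyclic =
  subst (_≤ cost o) (sym half-square) (Bound.cost-bound o acyclic h' (double h'))
  where
  double : ∀ h' → suc h' * 2 ≡ suc h' + suc h'
  double = solve-∀
  square-of-double : ∀ h' → suc h' * 2 * (suc h' * 2) ≡ 2 * (suc h' * suc h') * 2
  square-of-double = solve-∀
  half-square : (suc h' * 2 * (suc h' * 2)) / 2 ≡ 2 * (suc h' * suc h')
  half-square = trans (cong (_/ 2) (square-of-double h')) (m*n/n≡m _ 2)
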